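{- For all positive integers $t,N,q$, $f_N^*(q,tN-N,t)\le p_t(N,q)$. Furthermore, $\frac{N!}{N^N}f_N(Nq,tN-N,t)\le p_t(N,q)$.
   Context: A $PHF(N;n,q,t)$ is an $N\times n$ matrix over $[q]$ such that for every set of $t$ columns there is a row in which these $t$ columns have pairwise distinct entries; $p_t(N,q)$ is the maximum such $n$. An $r$-uniform hypergraph is $G(v,e)$-free if the union of any $e$ distinct edges has at least $v+1$ vertices. $f_r(n,v,e)$ is the maximum number of edges of a $G(v,e)$-free $r$-uniform hypergraph on $n$ vertices, and $f_r^*(q,v,e)$ is the maximum number of edges of a $G(v,e)$-free $r$-uniform $r$-partite hypergraph whose $r$ parts each have exactly $q$ vertices (each edge meeting each part in exactly one vertex). -}

module Defs where

open import Data.Nat using (ℕ; _<_)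
open import Data.Fin using (Fin; combine)
open import Data.Fin.Subset using (Subset; ⋃; ∣_∣; ⁅_⁆)
open import Data.List using (tabulate)
open import Data.Vec using (Vec; lookup)
open import Data.Product using (∃)
open import Function.Definitions using (Injective)
open import Relation.Binary.PropositionalEquality using (_≡_)

Union : ∀ {n e} → (Fin e → Subset n) → Subset n
Union f = ⋃ (tabulate f)

-- A hypergraph with m (labelled) edges on vertex set Fin n is a family
-- E : Fin m → Subset n. Edges are distinct when E is injective.
Distinct : ∀ {n m} → (Fin m → Subset n) → Set
Distinct E = Injective _≡_ _≡_ E

Uniform : ∀ {n m} → ℕ → (Fin m → Subset n) → Set
Uniform r E = ∀ i → ∣ E i ∣ ≡ r

Free : ∀ {n m} → ℕ → ℕ → (Fin m → Subset n) → Set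
Free {m = m} v e E =
  (σ : Fin e → Fin m) → Injective _≡_ _≡_ σ → v < ∣ Union (λ j → E (σ j)) ∣

-- r-partite hypergraph with parts of size q: vertex set Fin r × Fin q,
-- encoded as Fin (r * q) via combine (part i, vertex x ↦ combine i x).
-- An edge picks one vertex x_i in each part i, i.e. a Vec (Fin q) r.
partiteEdge : ∀ {r q} → Vec (Fin q) r → Subset (r Data.Nat.* q)
partiteEdge {r} x = Union (λ i → ⁅ combine i (lookup x i) ⁆)

IsPHF : ∀ {N n q} → ℕ → (Fin N → Fin n → Fin q) → Set
IsPHF {N} {n} t M =
  (c : Fin t → Fin n) → Injective _≡_ _≡_ c →
  ∃ λ (row : Fin N) → Injective _≡_ _≡_ (λ j → M row (c j))

module Submission where

-- Both bounds rest on one observation (module TransversalCover): if every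
-- edge of a hypergraph is covered by a transversal {V i (X j i) ∣ i < N} of
-- an N × q grid of vertices, and any t edges span more than tN - N
-- vertices, then the matrix X of the transversals is a PHF, since a row in
-- which the t chosen columns collide contributes at most t - 1 vertices.
-- For an N-partite hypergraph with parts of size q the edges themselves are
-- such transversals (partitePHF), giving the first bound.
--
-- For an arbitrary N-uniform hypergraph on N q vertices we colour the
-- vertices with N colours, using one permutation of Fin N in each of q
-- columns; the colour classes form an N × q grid and every rainbow edge is
-- a transversal of it.  Permutations are enumerated by Lehmer codes in
-- Fin (N !).  Counting the permutations that map a set A into a set T
-- (successes≡) and chaining these counts over the columns (chains-bound)
-- shows that a fixed N-edge is rainbow for at least a fraction N!/N^N of
-- the colourings.  Averaging over all colourings
-- gives one with at least (N!/N^N) m rainbow edges (module Recolouring).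

open import Defs
open import Data.Nat using (ℕ; _≤_; _*_; _∸_; _^_; _!)
open import Data.Fin using (Fin)
open import Data.Fin.Subset using (Subset)
open import Data.Vec using (Vec)
open import Data.Product using (∃; ∃₂; _×_)
open import Function.Definitions using (Injective)
open import Relation.Binary.PropositionalEquality using (_≡_)

open import Data.Nat using (zero; suc; _+_; _<_; z≤n; s≤s; NonZero; _≤?_)
open import Data.Nat.Properties
open import Data.Bool using (Bool; true; false; not; _∧_) renaming (_≟_ to _≟ᵇ_)
open import Data.Bool.Properties using (not-¬)
open import Data.Maybe using (Maybe; just; nothing; is-just; maybe′)
import Data.Maybe as Maybe
open import Data.Fin using (zero; suc; punchIn; punchOut; combine; remQuot; quotient; remainder; finToFun; _↑ˡ_; _↑ʳ_)
open import Data.Fin.Properties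
  using (any?; all?; ¬∀⟶∃¬; punchIn-punchOut; punchIn-injective; punchInᵢ≢i; remQuot-combine; combine-remQuot)
  renaming (_≟_ to _≟ᶠ_; suc-injective to sucᶠ-injective)
open import Data.Fin.Subset using (∣_∣; ⁅_⁆; _∪_; _∈_; _⊆_)
open import Data.Fin.Subset.Properties
  using (x∈p∪q⁻; x∈p∪q⁺; x∈⁅x⁆; x∈⁅y⁆⇒x≡y; ∣⁅x⁆∣≡1; p⊆q⇒∣p∣≤∣q∣; ∣⊥∣≡0; ∉⊥)
open import Data.Vec using ([]; _∷_; lookup)
open import Data.Vec.Properties using ([]=⇒lookup)
open import Data.Product using (Σ; _,_; uncurry) renaming (map to Σ-map)
open import Data.Sum using (inj₁; inj₂)
open import Function using (_∘_; case_of_)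
open import Data.Nat.Tactic.RingSolver using (solve-∀)
open import Relation.Nullary using (¬_; Dec; yes; no; ¬?; contradiction)
open import Relation.Nullary.Decidable using (_×-dec_)
open import Relation.Binary.PropositionalEquality using (refl; sym; trans; cong; cong₂; subst; subst₂; _≢_; module ≡-Reasoning)
open import Data.Vec.Functional using (removeAt; insertAt)
open import Data.Vec.Functional.Properties using (insertAt-lookup; insertAt-punchIn)
open import Algebra.Properties.Semiring.Sum +-*-semiring
  using (sum; sum-syntax; ∑-comm; *-distribˡ-sum; *-distribʳ-sum; sum-cong-≗; sum-remove)
open import Algebra.Properties.CommutativeSemigroup +-commutativeSemigroup
  using () renaming (interchange to +-interchange; x∙yz≈y∙xz to x+[y+z]≡y+[x+z])
open import Algebra.Properties.CommutativeSemigroup *-commutativeSemigroup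
  using () renaming (x∙yz≈y∙xz to x*[y*z]≡y*[x*z])

sum-mono-≤ : ∀ {n} {f g : Fin n → ℕ} → (∀ i → f i ≤ g i) → sum f ≤ sum g
sum-mono-≤ {zero}  f≤g = z≤n
sum-mono-≤ {suc n} f≤g = +-mono-≤ (f≤g zero) (sum-mono-≤ (f≤g ∘ suc))

sum-mono-< : ∀ {n} .{{_ : NonZero n}} {f g : Fin n → ℕ} → (∀ i → f i < g i) → sum f < sum g
sum-mono-< {suc n} f<g = +-mono-<-≤ (f<g zero) (sum-mono-≤ (λ i → <⇒≤ (f<g (suc i))))

sum-const : ∀ n c → ∑[ i < n ] c ≡ n * c
sum-const zero    c = refl
sum-const (suc n) c = cong (c +_) (sum-const n c)

averaging : ∀ {n} .{{_ : NonZero n}} (f g : Fin n → ℕ) → sum g ≤ sum f → ∃ λ i → g i ≤ f i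
averaging f g ∑g≤∑f with any? (λ i → g i ≤? f i)
... | yes found = found
... | no  none  = contradiction ∑g≤∑f
  (<⇒≱ (sum-mono-< (λ i → ≰⇒> (λ gᵢ≤fᵢ → none (i , gᵢ≤fᵢ)))))

sum-↑ : ∀ m n (f : Fin (m + n) → ℕ) →
  sum f ≡ ∑[ i < m ] f (i ↑ˡ n) + ∑[ j < n ] f (m ↑ʳ j)
sum-↑ zero    n f = refl
sum-↑ (suc m) n f = trans (cong (f zero +_) (sum-↑ m n (f ∘ suc))) (sym (+-assoc (f zero) _ _))

sum-combine : ∀ m n (f : Fin (m * n) → ℕ) → sum f ≡ ∑[ i < m ] ∑[ j < n ] f (combine i j)
sum-combine zero    n f = refl
sum-combine (suc m) n f =
  trans (sum-↑ n (m * n) f) (cong (∑[ j < n ] f (j ↑ˡ (m * n)) +_) (sum-combine m n (f ∘ (n ↑ʳ_))))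

sum-remQuot : ∀ m n (g : Fin m → Fin n → ℕ) →
  ∑[ c < m * n ] uncurry g (remQuot n c) ≡ ∑[ i < m ] ∑[ j < n ] g i j
sum-remQuot m n g = trans (sum-combine m n _)
  (sum-cong-≗ (λ i → sum-cong-≗ (λ j → cong (uncurry g) (remQuot-combine i j))))

∣p∪q∣≤∣p∣+∣q∣ : ∀ {n} (p q : Subset n) → ∣ p ∪ q ∣ ≤ ∣ p ∣ + ∣ q ∣
∣p∪q∣≤∣p∣+∣q∣ []          []          = z≤n
∣p∪q∣≤∣p∣+∣q∣ (false ∷ p) (false ∷ q) = ∣p∪q∣≤∣p∣+∣q∣ p q
∣p∪q∣≤∣p∣+∣q∣ (false ∷ p) (true  ∷ q) = ≤-trans (s≤s (∣p∪q∣≤∣p∣+∣q∣ p q)) (≤-reflexive (sym (+-suc _ _)))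
∣p∪q∣≤∣p∣+∣q∣ (true  ∷ p) (false ∷ q) = s≤s (∣p∪q∣≤∣p∣+∣q∣ p q)
∣p∪q∣≤∣p∣+∣q∣ (true  ∷ p) (true  ∷ q) = s≤s (≤-trans (∣p∪q∣≤∣p∣+∣q∣ p q) (+-monoʳ-≤ ∣ p ∣ (n≤1+n _)))

∣Union∣≤∑ : ∀ {n e} (f : Fin e → Subset n) → ∣ Union f ∣ ≤ ∑[ j < e ] ∣ f j ∣
∣Union∣≤∑ {n} {zero}  f = ≤-reflexive (∣⊥∣≡0 n)
∣Union∣≤∑ {n} {suc e} f = ≤-trans (∣p∪q∣≤∣p∣+∣q∣ (f zero) (Union (f ∘ suc)))
  (+-monoʳ-≤ ∣ f zero ∣ (∣Union∣≤∑ (f ∘ suc)))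

∈Union⁻ : ∀ {n e} (f : Fin e → Subset n) {x} → x ∈ Union f → ∃ λ j → x ∈ f j
∈Union⁻ {e = zero}  f x∈⊥ = contradiction x∈⊥ ∉⊥
∈Union⁻ {e = suc e} f x∈∪ with x∈p∪q⁻ (f zero) (Union (f ∘ suc)) x∈∪
... | inj₁ x∈f₀ = zero , x∈f₀
... | inj₂ x∈∪′ with ∈Union⁻ (f ∘ suc) x∈∪′
...   | j , x∈fⱼ = suc j , x∈fⱼ

∈Union⁺ : ∀ {n e} (f : Fin e → Subset n) {x} j → x ∈ f j → x ∈ Union f
∈Union⁺ {e = suc e} f zero    x∈f₀ = x∈p∪q⁺ (inj₁ x∈f₀)
∈Union⁺ {e = suc e} f (suc j) x∈fⱼ = x∈p∪q⁺ {p = f zero} (inj₂ (∈Union⁺ (f ∘ suc) j x∈fⱼ))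

Union-⊆ : ∀ {n e e′} (f : Fin e → Subset n) (g : Fin e′ → Subset n) →
  (∀ j → ∃ λ k → f j ⊆ g k) → Union f ⊆ Union g
Union-⊆ f g f⊆g x∈∪f with ∈Union⁻ f x∈∪f
... | j , x∈fⱼ with f⊆g j
...   | k , fⱼ⊆gₖ = ∈Union⁺ g k (fⱼ⊆gₖ x∈fⱼ)

≡⇒∈⁅⁆ : ∀ {n} {x y : Fin n} → x ≡ y → x ∈ ⁅ y ⁆
≡⇒∈⁅⁆ {x = x} refl = x∈⁅x⁆ x

∣image∣≤ : ∀ {n e} (g : Fin e → Fin n) → ∣ Union (λ l → ⁅ g l ⁆) ∣ ≤ e
∣image∣≤ {e = e} g = begin
  ∣ Union (λ l → ⁅ g l ⁆) ∣  ≤⟨ ∣Union∣≤∑ (λ l → ⁅ g l ⁆) ⟩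
  ∑[ l < e ] ∣ ⁅ g l ⁆ ∣    ≡⟨ sum-cong-≗ (λ l → ∣⁅x⁆∣≡1 (g l)) ⟩
  ∑[ l < e ] 1              ≡⟨ sum-const e 1 ⟩
  e * 1                     ≡⟨ *-identityʳ e ⟩
  e                         ∎
  where open ≤-Reasoning

Collides : ∀ {t q} → (Fin t → Fin q) → Set
Collides f = ∃₂ λ j k → j ≢ k × f j ≡ f k

collides? : ∀ {t q} (f : Fin t → Fin q) → Dec (Collides f)
collides? f = any? (λ j → any? (λ k → ¬? (j ≟ᶠ k) ×-dec (f j ≟ᶠ f k)))

¬collides⇒injective : ∀ {t q} (f : Fin t → Fin q) → ¬ Collides f → Injective _≡_ _≡_ f
¬collides⇒injective f noCollision {j} {k} fj≡fk with j ≟ᶠ k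
... | yes j≡k = j≡k
... | no  j≢k = contradiction (j , k , j≢k , fj≡fk) noCollision

-- A colliding map on Fin (1 + t′) has at most t′ distinct values: all its
-- values are already attained once the index j of a repeated value is skipped.
∣image∣≤-collides : ∀ {n t′} (g : Fin (suc t′) → Fin n) → Collides g →
  ∣ Union (λ l → ⁅ g l ⁆) ∣ ≤ t′
∣image∣≤-collides g (j , k , j≢k , gj≡gk) =
  ≤-trans (p⊆q⇒∣p∣≤∣q∣ (Union-⊆ _ _ attained)) (∣image∣≤ (g ∘ punchIn j))
  where
  attained : ∀ l → ∃ λ l′ → ⁅ g l ⁆ ⊆ ⁅ g (punchIn j l′) ⁆
  attained l with l ≟ᶠ j
  ... | yes refl = punchOut j≢k , λ {x} x∈ → ≡⇒∈⁅⁆ (begin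
          x                        ≡⟨ x∈⁅y⁆⇒x≡y (g l) x∈ ⟩
          g l                      ≡⟨ gj≡gk ⟩
          g k                      ≡⟨ cong g (punchIn-punchOut j≢k) ⟨
          g (punchIn j (punchOut j≢k)) ∎)
    where open ≡-Reasoning
  ... | no  l≢j = punchOut (l≢j ∘ sym) , λ x∈ → ≡⇒∈⁅⁆
          (trans (x∈⁅y⁆⇒x≡y (g l) x∈) (cong g (sym (punchIn-punchOut (l≢j ∘ sym)))))

-- Let the cell V i x (row i ∈ Fin N, symbol x ∈ Fin q) be a vertex of
-- Fin K, and let column j of the N × n matrix X describe the transversal
-- {V i (X j i) ∣ i} covering the edge F j.  A row in which the t chosen
-- columns are not separated contributes at most t - 1 vertices, so if no row
-- separates them, their edges span at most N(t - 1) = tN - N vertices.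
module TransversalCover {K N q n : ℕ}
  (V : Fin N → Fin q → Fin K) (X : Fin n → Fin N → Fin q) (F : Fin n → Subset K)
  (F⊆transversal : ∀ j → F j ⊆ Union (λ i → ⁅ V i (X j i) ⁆)) where

  ∣Union∣≤-allCollide : ∀ {t′} (c : Fin (suc t′) → Fin n) →
    (∀ i → Collides (λ j → X (c j) i)) → ∣ Union (F ∘ c) ∣ ≤ N * t′
  ∣Union∣≤-allCollide {t′} c collide = begin
    ∣ Union (F ∘ c) ∣         ≤⟨ p⊆q⇒∣p∣≤∣q∣ ⋃F⊆⋃W ⟩
    ∣ Union W ∣               ≤⟨ ∣Union∣≤∑ W ⟩
    ∑[ i < N ] ∣ W i ∣        ≤⟨ sum-mono-≤ (λ i → ∣image∣≤-collides _ (collidesᵥ i (collide i))) ⟩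
    ∑[ i < N ] t′             ≡⟨ sum-const N t′ ⟩
    N * t′                    ∎
    where
    open ≤-Reasoning
    W : Fin N → Subset K
    W i = Union (λ j → ⁅ V i (X (c j) i) ⁆)
    ⋃F⊆⋃W : Union (F ∘ c) ⊆ Union W
    ⋃F⊆⋃W x∈ with ∈Union⁻ (F ∘ c) x∈
    ... | j , x∈Fⱼ with ∈Union⁻ _ (F⊆transversal (c j) x∈Fⱼ)
    ...   | i , x∈Vᵢ = ∈Union⁺ W i (∈Union⁺ (λ j → ⁅ V i (X (c j) i) ⁆) j x∈Vᵢ)
    collidesᵥ : ∀ i → Collides (λ j → X (c j) i) → Collides (λ j → V i (X (c j) i))
    collidesᵥ i (j , k , j≢k , eq) = j , k , j≢k , cong (V i) eq

  isPHF : ∀ t → ((c : Fin t → Fin n) → Injective _≡_ _≡_ c → t * N ∸ N < ∣ Union (F ∘ c) ∣) →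
    IsPHF t (λ row col → X col row)
  isPHF zero free c c-inj =
    contradiction (subst (0 ∸ N <_) (∣⊥∣≡0 K) (free c c-inj)) (n≮0 {0 ∸ N})
  isPHF (suc t′) free c c-inj with all? (λ i → collides? (λ j → X (c j) i))
  ... | no  ¬allCollide with ¬∀⟶∃¬ N _ (λ i → collides? (λ j → X (c j) i)) ¬allCollide
  ...   | i , separated = i , ¬collides⇒injective _ separated
  isPHF (suc t′) free c c-inj | yes allCollide = contradiction
    (subst (∣ Union (F ∘ c) ∣ ≤_) tN∸N (∣Union∣≤-allCollide c allCollide))
    (<⇒≱ (free c c-inj))
    where
    tN∸N : N * t′ ≡ suc t′ * N ∸ N
    tN∸N = trans (*-comm N t′) (sym (m+n∸m≡n N (t′ * N)))

partitePHF : (t N q : ℕ) → (m : ℕ) (E : Fin m → Vec (Fin q) N) →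
  Free (t * N ∸ N) t (λ i → partiteEdge (E i)) →
  ∃₂ λ (n : ℕ) (M : Fin N → Fin n → Fin q) → IsPHF t M × m ≤ n
partitePHF t N q m E free = m , (λ row col → lookup (E col) row) , isPHF t free , ≤-refl
  where open TransversalCover combine (λ j i → lookup (E j) i) (λ j → partiteEdge (E j)) (λ j x∈ → x∈)

-- Falling factorials: falling s k = s (s - 1) ⋯ (s - k + 1), the number of
-- injections of a k-set into an s-set.
falling : ℕ → ℕ → ℕ
falling s zero    = 1
falling s (suc k) = s * falling (s ∸ 1) k

falling-suc : ∀ s k → falling s (suc k) ≡ falling s k * (s ∸ k)
falling-suc s zero    = trans (*-identityʳ s) (sym (+-identityʳ s))
falling-suc s (suc k) = begin
  s * falling (s ∸ 1) (suc k)           ≡⟨ cong (s *_) (falling-suc (s ∸ 1) k) ⟩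
  s * (falling (s ∸ 1) k * (s ∸ 1 ∸ k)) ≡⟨ *-assoc s _ _ ⟨
  falling s (suc k) * (s ∸ 1 ∸ k)       ≡⟨ cong (falling s (suc k) *_) (∸-+-assoc s 1 k) ⟩
  falling s (suc k) * (s ∸ suc k)       ∎
  where open ≡-Reasoning

falling-vanishes : ∀ s k → s < k → falling s k ≡ 0
falling-vanishes zero    (suc k) _         = refl
falling-vanishes (suc s) (suc k) (s≤s s<k) =
  trans (cong (suc s *_) (falling-vanishes s k s<k)) (*-zeroʳ (suc s))

-- Choosing k images and then l more among the remaining s - k.
falling-+ : ∀ s k l → falling s k * falling (s ∸ k) l ≡ falling s (k + l)
falling-+ s zero    l = +-identityʳ (falling s l)
falling-+ s (suc k) l = begin
  s * falling (s ∸ 1) k * falling (s ∸ suc k) l   ≡⟨ *-assoc s _ _ ⟩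
  s * (falling (s ∸ 1) k * falling (s ∸ suc k) l) ≡⟨ cong (λ r → s * (falling (s ∸ 1) k * falling r l)) (∸-+-assoc s 1 k) ⟨
  s * (falling (s ∸ 1) k * falling (s ∸ 1 ∸ k) l) ≡⟨ cong (s *_) (falling-+ (s ∸ 1) k l) ⟩
  s * falling (s ∸ 1) (k + l)                     ∎
  where open ≡-Reasoning

falling-self : ∀ n → falling n n ≡ n !
falling-self zero    = refl
falling-self (suc n) = cong (suc n *_) (falling-self n)

-- s (s - 1)_k + r (s)_k = (s)_k (s + r - k): the choices for the next k
-- elements, according to whether the current one uses a colour of an s-set.
falling-recurrence : ∀ s r k → s * falling (s ∸ 1) k + r * falling s k ≡ falling s k * (s + r ∸ k)
falling-recurrence s r k = begin
  s * falling (s ∸ 1) k + r * falling s k     ≡⟨ cong₂ _+_ (falling-suc s k) (*-comm r (falling s k)) ⟩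
  falling s k * (s ∸ k) + falling s k * r     ≡⟨ *-distribˡ-+ (falling s k) (s ∸ k) r ⟨
  falling s k * (s ∸ k + r)                   ≡⟨ absorb (k ≤? s) ⟩
  falling s k * (s + r ∸ k)                   ∎
  where
  open ≡-Reasoning
  absorb : Dec (k ≤ s) → falling s k * (s ∸ k + r) ≡ falling s k * (s + r ∸ k)
  absorb (yes k≤s) = cong (falling s k *_) (sym (+-∸-comm r k≤s))
  absorb (no  k≰s) rewrite falling-vanishes s k (≰⇒> k≰s) = refl

-- (k + d)! ≤ d! (k + d)^k: each of the top k factors is at most k + d.
!-≤ : ∀ k d → (k + d) ! ≤ d ! * (k + d) ^ k
!-≤ zero    d = ≤-reflexive (sym (*-identityʳ (d !)))
!-≤ (suc k) d = begin
  suc (k + d) * (k + d) !                  ≤⟨ *-monoʳ-≤ (suc (k + d)) (!-≤ k d) ⟩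
  suc (k + d) * (d ! * (k + d) ^ k)        ≤⟨ *-monoʳ-≤ (suc (k + d)) (*-monoʳ-≤ (d !) (^-monoˡ-≤ k (n≤1+n (k + d)))) ⟩
  suc (k + d) * (d ! * suc (k + d) ^ k)    ≡⟨ x*[y*z]≡y*[x*z] (suc (k + d)) (d !) _ ⟩
  d ! * (suc (k + d) * suc (k + d) ^ k)    ∎
  where open ≤-Reasoning

!≤[∸]!*^ : ∀ {n k} → k ≤ n → n ! ≤ (n ∸ k) ! * n ^ k
!≤[∸]!*^ {n} {k} k≤n = subst (λ m → m ! ≤ (m ∸ k) ! * m ^ k) (m+[n∸m]≡n k≤n)
  (subst (λ d → (k + (n ∸ k)) ! ≤ d ! * (k + (n ∸ k)) ^ k) (sym (m+n∸m≡n k (n ∸ k))) (!-≤ k (n ∸ k)))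

ind : Bool → ℕ
ind true  = 1
ind false = 0

count : ∀ {n} → (Fin n → Bool) → ℕ
count {n} P = ∑[ i < n ] ind (P i)

count≤ : ∀ {n} (P : Fin n → Bool) → count P ≤ n
count≤ {zero}  P = z≤n
count≤ {suc n} P with P zero
... | true  = s≤s (count≤ (P ∘ suc))
... | false = ≤-trans (count≤ (P ∘ suc)) (n≤1+n n)

count+count-not : ∀ {n} (P : Fin n → Bool) → count P + count (not ∘ P) ≡ n
count+count-not {zero}  P = refl
count+count-not {suc n} P with P zero
... | true  = cong suc (count+count-not (P ∘ suc))
... | false = trans (+-suc _ _) (cong suc (count+count-not (P ∘ suc)))

sum-by-value : ∀ {n} (P : Fin n → Bool) (h : Bool → ℕ) →
  ∑[ i < n ] h (P i) ≡ count P * h true + count (not ∘ P) * h false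
sum-by-value {zero}  P h = refl
sum-by-value {suc n} P h with P zero
... | true  = trans (cong (h true +_) (sum-by-value (P ∘ suc) h)) (sym (+-assoc (h true) _ _))
... | false = trans (cong (h false +_) (sum-by-value (P ∘ suc) h))
                    (x+[y+z]≡y+[x+z] (h false) (count (P ∘ suc) * h true) _)

count-removeAt : ∀ {n} (P : Fin (suc n) → Bool) i → count P ≡ ind (P i) + count (removeAt P i)
count-removeAt P i = sum-remove (ind ∘ P)

count-insertAt : ∀ {n} (P : Fin n → Bool) i v → count (insertAt P i v) ≡ ind v + count P
count-insertAt P i v = trans (count-removeAt (insertAt P i v) i)
  (cong₂ _+_ (cong ind (insertAt-lookup P i v)) (sum-cong-≗ (cong ind ∘ insertAt-punchIn P i v)))

-- Since (1 + n)! = (1 + n) · n!, a code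
-- c : Fin ((1 + n)!) decodes (by remQuot) into the image i of 0 and a code
-- for the permutation of the remaining n elements, which is inserted
-- around i.
_◃_ : ∀ {n} → Fin (suc n) → (Fin n → Fin n) → Fin (suc n) → Fin (suc n)
(i ◃ π) zero    = i
(i ◃ π) (suc a) = punchIn i (π a)

◃-injective : ∀ {n} (i : Fin (suc n)) {π : Fin n → Fin n} →
  Injective _≡_ _≡_ π → Injective _≡_ _≡_ (i ◃ π)
◃-injective i π-inj {zero}  {zero}  _  = refl
◃-injective i π-inj {zero}  {suc b} eq = contradiction (sym eq) (punchInᵢ≢i i _)
◃-injective i π-inj {suc a} {zero}  eq = contradiction eq (punchInᵢ≢i i _)
◃-injective i π-inj {suc a} {suc b} eq = cong suc (π-inj (punchIn-injective i _ _ eq))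

perm : ∀ {n} → Fin (n !) → Fin n → Fin n
perm {zero}  c ()
perm {suc n} c = quotient {suc n} (n !) c ◃ perm (remainder {suc n} (n !) c)

perm-injective : ∀ {n} (c : Fin (n !)) → Injective _≡_ _≡_ (perm c)
perm-injective {zero}  c {()}
perm-injective {suc n} c =
  ◃-injective (quotient {suc n} (n !) c) (perm-injective {n} (remainder {suc n} (n !) c))

unperm : ∀ {n} → Fin (n !) → Fin n → Fin n
unperm {n} c i with any? (λ a → perm {n} c a ≟ᶠ i)
... | yes (a , _) = a
... | no  _       = i

unperm-perm : ∀ {n} (c : Fin (n !)) a → unperm c (perm c a) ≡ a
unperm-perm {n} c a with any? (λ b → perm {n} c b ≟ᶠ perm c a)
... | yes (b , πb≡πa) = perm-injective c πb≡πa
... | no  none        = contradiction (a , refl) none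

-- Assigning a set A ⊆ Fin n into a set T ⊆ Fin n of available colours by a
-- permutation π: if π maps A into T, the result is T with π(A) removed.
record Assigned {n} (A T : Fin n → Bool) (π : Fin n → Fin n) (T′ : Fin n → Bool) : Set where
  field
    into    : ∀ a → A a ≡ true → T (π a) ≡ true
    used    : ∀ a → A a ≡ true → T′ (π a) ≡ false
    ⊆T      : ∀ x → T′ x ≡ true → T x ≡ true
    count≡  : count T′ + count A ≡ count T

assignStep : ∀ {n} → Bool → Bool → Fin (suc n) → Maybe (Fin n → Bool) → Maybe (Fin (suc n) → Bool)
assignStep true false i r = nothing
assignStep a    b     i r = Maybe.map (λ R → insertAt R i (not a ∧ b)) r

assign : ∀ {n} (A T : Fin n → Bool) → Fin (n !) → Maybe (Fin n → Bool)
assign {zero}  A T c = just T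
assign {suc n} A T c = assignStep (A zero) (T i) i (assign (A ∘ suc) (removeAt T i) (remainder {suc n} (n !) c))
  where i = quotient {suc n} (n !) c

ind-step : ∀ a b → (a ≡ true → b ≡ true) → ind (not a ∧ b) + ind a ≡ ind b
ind-step true  true  _     = refl
ind-step true  false a⇒b   = contradiction (a⇒b refl) (λ ())
ind-step false b     _     = +-identityʳ (ind b)

∧-true⇒right : ∀ a b → a ∧ b ≡ true → b ≡ true
∧-true⇒right true b eq = eq

assigned-◃ : ∀ {n} {A T : Fin (suc n) → Bool} {i π R} {a b} →
  A zero ≡ a → T i ≡ b → (a ≡ true → b ≡ true) →
  Assigned (A ∘ suc) (removeAt T i) π R → Assigned A T (i ◃ π) (insertAt R i (not a ∧ b))
assigned-◃ {A = A} {T} {i} {π} {R} {a} {b} A₀≡a Tᵢ≡b a⇒b S = record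
  { into   = λ { zero A₀ → trans Tᵢ≡b (a⇒b (trans (sym A₀≡a) A₀)) ; (suc a′) → into a′ }
  ; used   = λ { zero A₀ → trans (insertAt-lookup R i _) (cong (λ a → not a ∧ b) (trans (sym A₀≡a) A₀))
               ; (suc a′) Aₐ → trans (insertAt-punchIn R i _ (π a′)) (used a′ Aₐ) }
  ; ⊆T     = ⊆T′
  ; count≡ = begin
      count (insertAt R i (not a ∧ b)) + count A          ≡⟨ cong₂ _+_ (count-insertAt R i _) (cong (_+ count (A ∘ suc)) (cong ind A₀≡a)) ⟩
      ind (not a ∧ b) + count R + (ind a + count (A ∘ suc)) ≡⟨ +-interchange (ind (not a ∧ b)) (count R) (ind a) _ ⟩
      ind (not a ∧ b) + ind a + (count R + count (A ∘ suc)) ≡⟨ cong₂ _+_ (ind-step a b a⇒b) count≡ ⟩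
      ind b + count (removeAt T i)                          ≡⟨ cong (λ b → ind b + _) Tᵢ≡b ⟨
      ind (T i) + count (removeAt T i)                      ≡⟨ count-removeAt T i ⟨
      count T                                               ∎
  }
  where
  open Assigned S
  open ≡-Reasoning
  ⊆T′ : ∀ x → insertAt R i (not a ∧ b) x ≡ true → T x ≡ true
  ⊆T′ x avail with i ≟ᶠ x
  ... | yes refl = trans Tᵢ≡b (∧-true⇒right (not a) b (trans (sym (insertAt-lookup R i _)) avail))
  ... | no  i≢x  = subst (λ y → T y ≡ true) (punchIn-punchOut i≢x)
    (⊆T (punchOut i≢x) (trans (sym (insertAt-punchIn R i _ (punchOut i≢x)))
      (subst (λ y → insertAt R i _ y ≡ true) (sym (punchIn-punchOut i≢x)) avail)))

assign-sound : ∀ {n} (A T : Fin n → Bool) c {T′} → assign A T c ≡ just T′ → Assigned A T (perm c) T′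
assign-sound {zero}  A T c refl = record { into = λ () ; used = λ () ; ⊆T = λ x p → p ; count≡ = refl }
assign-sound {suc n} A T c eq
  with A zero in A₀≡a | T (quotient {suc n} (n !) c) in Tᵢ≡b
     | assign (A ∘ suc) (removeAt T (quotient {suc n} (n !) c)) (remainder {suc n} (n !) c) in r≡
... | true  | false | _       = case eq of λ ()
... | true  | true  | nothing = case eq of λ ()
... | false | _     | nothing = case eq of λ ()
... | true  | true  | just R  = case eq of λ { refl → assigned-◃ A₀≡a Tᵢ≡b (λ _ → refl) (assign-sound _ _ _ r≡) }
... | false | b     | just R  = case eq of λ { refl → assigned-◃ A₀≡a Tᵢ≡b (λ ()) (assign-sound _ _ _ r≡) }

successes : ∀ {n} (A T : Fin n → Bool) → ℕ
successes {n} A T = count (λ c → is-just (assign {n} A T c))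

allowed : Bool → Bool → ℕ
allowed true  b = ind b
allowed false b = 1

ind-assignStep : ∀ {n} a b (i : Fin (suc n)) r →
  ind (is-just (assignStep a b i r)) ≡ allowed a b * ind (is-just r)
ind-assignStep true  false i r        = refl
ind-assignStep true  true  i nothing  = refl
ind-assignStep true  true  i (just _) = refl
ind-assignStep false b     i nothing  = refl
ind-assignStep false b     i (just _) = refl

successes-suc : ∀ {n} (A T : Fin (suc n) → Bool) →
  successes A T ≡ ∑[ i < suc n ] (allowed (A zero) (T i) * successes (A ∘ suc) (removeAt T i))
successes-suc {n} A T = trans (sum-remQuot (suc n) (n !) byImage) (sum-cong-≗ λ i →
  trans (sum-cong-≗ (λ c → ind-assignStep (A zero) (T i) i (assign (A ∘ suc) (removeAt T i) c)))
        (sym (*-distribˡ-sum (allowed (A zero) (T i)) (λ c → ind (is-just (assign (A ∘ suc) (removeAt T i) c))))))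
  where
  byImage : Fin (suc n) → Fin (n !) → ℕ
  byImage i c = ind (is-just (assignStep (A zero) (T i) i (assign (A ∘ suc) (removeAt T i) c)))

count-removeAt-∸ : ∀ {n} (T : Fin (suc n) → Bool) i → count (removeAt T i) ≡ count T ∸ ind (T i)
count-removeAt-∸ T i = sym (trans (cong (_∸ ind (T i)) (count-removeAt T i)) (m+n∸m≡n (ind (T i)) _))

SuccessesFormula : ∀ {n} → (Fin n → Bool) → Set
SuccessesFormula {n} A = ∀ T d → n ≡ count A + d → successes A T ≡ falling (count T) (count A) * d !

-- If the first element lies in A, it must take one of the s colours of T,
-- after which the others must map into the remaining s - 1 colours.
successes-hit : ∀ {n} (A T : Fin (suc n) → Bool) d → A zero ≡ true → suc n ≡ count A + d →
  SuccessesFormula (A ∘ suc) → successes A T ≡ falling (count T) (count A) * d !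
successes-hit {n} A T d A₀ n≡ IH = begin
  successes A T                                                 ≡⟨ successes-suc A T ⟩
  ∑[ i < suc n ] (allowed (A zero) (T i) * rest i)              ≡⟨ sum-cong-≗ (λ i → cong (λ a → allowed a (T i) * rest i) A₀) ⟩
  ∑[ i < suc n ] (ind (T i) * rest i)                           ≡⟨ sum-cong-≗ per ⟩
  ∑[ i < suc n ] (ind (T i) * K)                                ≡⟨ *-distribʳ-sum K (ind ∘ T) ⟨
  s * K                                                         ≡⟨ *-assoc s _ _ ⟨
  falling s (suc k′) * d !                                      ≡⟨ cong (λ a → falling s (ind a + k′) * d !) A₀ ⟨
  falling s (count A) * d !                                     ∎
  where
  open ≡-Reasoning
  s = count T
  k′ = count (A ∘ suc)
  rest : Fin (suc n) → ℕ
  rest i = successes (A ∘ suc) (removeAt T i)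
  K = falling (s ∸ 1) k′ * d !
  per : ∀ i → ind (T i) * rest i ≡ ind (T i) * K
  per i with T i in Tᵢ
  ... | false = refl
  ... | true  = cong (_+ 0) (begin
    rest i                                    ≡⟨ IH (removeAt T i) d (suc-injective (trans n≡ (cong (λ a → ind a + k′ + d) A₀))) ⟩
    falling (count (removeAt T i)) k′ * d !   ≡⟨ cong (λ r → falling r k′ * d !) (trans (count-removeAt-∸ T i) (cong (λ b → s ∸ ind b) Tᵢ)) ⟩
    K                                         ∎)

-- If the first element is outside A, its colour i is unconstrained and
-- removes one available colour exactly when i ∈ T.
successes-miss : ∀ {n} (A T : Fin (suc n) → Bool) d → A zero ≡ false → suc n ≡ count A + d →
  SuccessesFormula (A ∘ suc) → successes A T ≡ falling (count T) (count A) * d !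
successes-miss {n} A T zero A₀ n≡ IH = contradiction (count≤ (A ∘ suc))
  (<⇒≱ (≤-reflexive (trans n≡ (trans (cong (λ a → ind a + count (A ∘ suc) + 0) A₀) (+-identityʳ _)))))
successes-miss {n} A T (suc d′) A₀ n≡ IH = begin
  successes A T                                            ≡⟨ successes-suc A T ⟩
  ∑[ i < suc n ] (allowed (A zero) (T i) * rest i)         ≡⟨ sum-cong-≗ (λ i → cong (λ a → allowed a (T i) * rest i) A₀) ⟩
  ∑[ i < suc n ] (1 * rest i)                              ≡⟨ sum-cong-≗ per ⟩
  ∑[ i < suc n ] h (T i)                                   ≡⟨ sum-by-value T h ⟩
  s * h true + s̄ * h false                                 ≡⟨ cong₂ _+_ (*-assoc s _ _) (*-assoc s̄ _ _) ⟨
  s * falling (s ∸ 1) k′ * d′ ! + s̄ * falling s k′ * d′ !  ≡⟨ *-distribʳ-+ (d′ !) (s * _) (s̄ * _) ⟨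
  (s * falling (s ∸ 1) k′ + s̄ * falling s k′) * d′ !      ≡⟨ cong (_* d′ !) (falling-recurrence s s̄ k′) ⟩
  falling s k′ * (s + s̄ ∸ k′) * d′ !                       ≡⟨ cong (λ r → falling s k′ * r * d′ !) s+s̄∸k′≡ ⟩
  falling s k′ * suc d′ * d′ !                             ≡⟨ *-assoc (falling s k′) (suc d′) (d′ !) ⟩
  falling s k′ * suc d′ !                                  ≡⟨ cong (λ a → falling s (ind a + k′) * suc d′ !) A₀ ⟨
  falling s (count A) * suc d′ !                           ∎
  where
  open ≡-Reasoning
  s = count T
  s̄ = count (not ∘ T)
  k′ = count (A ∘ suc)
  rest : Fin (suc n) → ℕ
  rest i = successes (A ∘ suc) (removeAt T i)
  n≡k′+d : suc n ≡ k′ + suc d′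
  n≡k′+d = trans n≡ (cong (λ a → ind a + k′ + suc d′) A₀)
  h : Bool → ℕ
  h b = falling (s ∸ ind b) k′ * d′ !
  s+s̄∸k′≡ : s + s̄ ∸ k′ ≡ suc d′
  s+s̄∸k′≡ = trans (cong (_∸ k′) (trans (count+count-not T) n≡k′+d)) (m+n∸m≡n k′ (suc d′))
  per : ∀ i → 1 * rest i ≡ h (T i)
  per i = begin
    1 * rest i                                ≡⟨ *-identityˡ _ ⟩
    rest i                                    ≡⟨ IH (removeAt T i) d′ (suc-injective (trans n≡k′+d (+-suc k′ d′))) ⟩
    falling (count (removeAt T i)) k′ * d′ !  ≡⟨ cong (λ r → falling r k′ * d′ !) (count-removeAt-∸ T i) ⟩
    h (T i)                                   ∎

successes≡ : ∀ {n} (A : Fin n → Bool) → SuccessesFormula A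
successes≡ {zero}  A T zero refl = refl
successes≡ {suc n} A = byFirst (A zero) refl
  where
  byFirst : ∀ a → A zero ≡ a → SuccessesFormula A
  byFirst true  A₀ T d n≡ = successes-hit  A T d A₀ n≡ (successes≡ (A ∘ suc))
  byFirst false A₀ T d n≡ = successes-miss A T d A₀ n≡ (successes≡ (A ∘ suc))

-- Chains: the sets As x ⊆ Fin N (x < r) are assigned in turn, the
-- permutation τ x placing As x into the colours left unused by the earlier
-- ones; chain reports whether every step succeeds.
chain : ∀ {N r} → (Fin r → Fin N → Bool) → (Fin N → Bool) → (Fin r → Fin (N !)) → Bool
chain {r = zero}  As T τ = true
chain {r = suc r} As T τ =
  maybe′ (λ T′ → chain (As ∘ suc) T′ (τ ∘ suc)) false (assign (As zero) T (τ zero))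

chain-into : ∀ {N r} (As : Fin r → Fin N → Bool) T τ → chain As T τ ≡ true →
  ∀ x a → As x a ≡ true → T (perm (τ x) a) ≡ true
chain-into {r = suc r} As T τ ok x a Aₓa with assign (As zero) T (τ zero) in assigned
... | just T′ with x
...   | zero   = Assigned.into (assign-sound (As zero) T (τ zero) assigned) a Aₓa
...   | suc x′ = Assigned.⊆T (assign-sound (As zero) T (τ zero) assigned) _
                   (chain-into (As ∘ suc) T′ (τ ∘ suc) ok x′ a Aₓa)

chain-disjoint : ∀ {N r} (As : Fin r → Fin N → Bool) T τ → chain As T τ ≡ true →
  ∀ {x y a b} → x ≢ y → As x a ≡ true → As y b ≡ true → perm (τ x) a ≢ perm (τ y) b
chain-disjoint {r = suc r} As T τ ok {x} {y} {a} {b} x≢y Aₓa Aᵧb with assign (As zero) T (τ zero) in assigned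
... | just T′ with x | y
...   | zero   | zero   = λ _ → x≢y refl
...   | zero   | suc y′ = λ eq → not-¬ (chain-into (As ∘ suc) T′ (τ ∘ suc) ok y′ b Aᵧb)
        (trans (cong T′ (sym eq)) (Assigned.used (assign-sound (As zero) T (τ zero) assigned) a Aₓa))
...   | suc x′ | zero   = λ eq → not-¬ (chain-into (As ∘ suc) T′ (τ ∘ suc) ok x′ a Aₓa)
        (trans (cong T′ eq) (Assigned.used (assign-sound (As zero) T (τ zero) assigned) b Aᵧb))
...   | suc x′ | suc y′ = chain-disjoint (As ∘ suc) T′ (τ ∘ suc) ok (x≢y ∘ cong suc) Aₓa Aᵧb

chains : ∀ {N} r → (Fin r → Fin N → Bool) → (Fin N → Bool) → ℕ
chains {N} r As T = count (λ τ → chain As T (finToFun {N !} {r} τ))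

total : ∀ {N r} → (Fin r → Fin N → Bool) → ℕ
total {r = r} As = ∑[ x < r ] count (As x)

-- The lower bound on successful chains: a uniformly random r-tuple succeeds
-- with probability at least (s)_S / N^S, where s = |T| and S = ∑ |As x|.
ChainsBound : ℕ → ℕ → Set
ChainsBound N r = ∀ (As : Fin r → Fin N → Bool) T →
  (N !) ^ r * falling (count T) (total As) ≤ chains r As T * N ^ total As

-- Splitting off the first permutation: each of its successes leaves
-- |T| - |As 0| colours, so by the bound for r it has many continuations.
chains-first : ∀ {N r} → ChainsBound N r → ∀ (As : Fin (suc r) → Fin N → Bool) T →
  successes (As zero) T * ((N !) ^ r * falling (count T ∸ count (As zero)) (total (As ∘ suc)))
    ≤ chains (suc r) As T * N ^ total (As ∘ suc)
chains-first {N} {r} IH As T = begin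
  successes A T * (P * F)                                ≡⟨ *-distribʳ-sum (P * F) (λ c → ind (is-just (assign A T c))) ⟩
  ∑[ c < N ! ] (ind (is-just (assign A T c)) * (P * F))  ≤⟨ sum-mono-≤ per ⟩
  ∑[ c < N ! ] ((∑[ τ′ < P ] after c τ′) * N ^ S′)       ≡⟨ *-distribʳ-sum (N ^ S′) (λ c → ∑[ τ′ < P ] after c τ′) ⟨
  (∑[ c < N ! ] ∑[ τ′ < P ] after c τ′) * N ^ S′         ≡⟨ cong (_* N ^ S′) (sum-remQuot (N !) P after) ⟨
  chains (suc r) As T * N ^ S′                           ∎
  where
  open ≤-Reasoning
  A = As zero
  S′ = total (As ∘ suc)
  P = (N !) ^ r
  F = falling (count T ∸ count A) S′
  after : Fin (N !) → Fin P → ℕ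
  after c τ′ = ind (maybe′ (λ T′ → chain (As ∘ suc) T′ (finToFun τ′)) false (assign A T c))
  per : ∀ c → ind (is-just (assign A T c)) * (P * F) ≤ (∑[ τ′ < P ] after c τ′) * N ^ S′
  per c with assign A T c in assigned
  ... | nothing = z≤n
  ... | just T′ = subst (λ m → P * falling m S′ + 0 ≤ chains r (As ∘ suc) T′ * N ^ S′) count-T′
                    (≤-trans (≤-reflexive (+-identityʳ _)) (IH (As ∘ suc) T′))
    where
    count-T′ : count T′ ≡ count T ∸ count A
    count-T′ = trans (sym (m+n∸n≡m (count T′) (count A)))
                     (cong (_∸ count A) (Assigned.count≡ (assign-sound A T c assigned)))

-- Combining chains-first with the count of successes of the first
-- permutation and N! ≤ (N - k)! N^k.
chains-bound : ∀ {N} r → ChainsBound N r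
chains-bound         zero    As T = ≤-refl
chains-bound {N = N} (suc r) As T = begin
  N ! * P * falling s (k + S′)                 ≡⟨ cong (N ! * P *_) (falling-+ s k S′) ⟨
  N ! * P * (falling s k * F)                  ≡⟨ reorder₁ (N !) P (falling s k) F ⟩
  falling s k * N ! * (P * F)                  ≤⟨ *-monoˡ-≤ (P * F) (*-monoʳ-≤ (falling s k) (!≤[∸]!*^ (count≤ A))) ⟩
  falling s k * ((N ∸ k) ! * N ^ k) * (P * F)  ≡⟨ reorder₂ (falling s k) ((N ∸ k) !) (N ^ k) (P * F) ⟩
  falling s k * (N ∸ k) ! * (P * F) * N ^ k    ≡⟨ cong (λ m → m * (P * F) * N ^ k) (successes≡ A T (N ∸ k) (sym (m+[n∸m]≡n (count≤ A)))) ⟨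
  successes A T * (P * F) * N ^ k              ≤⟨ *-monoˡ-≤ (N ^ k) (chains-first (chains-bound r) As T) ⟩
  chains (suc r) As T * N ^ S′ * N ^ k         ≡⟨ reorder₃ (chains (suc r) As T) (N ^ S′) (N ^ k) ⟩
  chains (suc r) As T * (N ^ k * N ^ S′)       ≡⟨ cong (chains (suc r) As T *_) (^-distribˡ-+-* N k S′) ⟨
  chains (suc r) As T * N ^ (k + S′)           ∎
  where
  open ≤-Reasoning
  A = As zero
  k = count A
  S′ = total (As ∘ suc)
  P = (N !) ^ r
  s = count T
  F = falling (s ∸ k) S′
  reorder₁ : ∀ a b c d → a * b * (c * d) ≡ c * a * (b * d)
  reorder₁ = solve-∀
  reorder₂ : ∀ a b c d → a * (b * c) * d ≡ a * b * d * c
  reorder₂ = solve-∀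
  reorder₃ : ∀ a b c → a * b * c ≡ a * (c * b)
  reorder₃ = solve-∀

select : ∀ {m} (P : Fin m → Bool) →
  Σ (Fin (count P) → Fin m) λ idx → Injective _≡_ _≡_ idx × (∀ j → P (idx j) ≡ true)
select {zero}  P = (λ ()) , (λ {j} → case j of λ ()) , λ ()
select {suc m} P with P zero in P₀ | select (P ∘ suc)
... | true  | idx , idx-inj , sat = idx′ , idx′-inj , sat′
  where
  idx′ : Fin (suc (count (P ∘ suc))) → Fin (suc m)
  idx′ zero    = zero
  idx′ (suc j) = suc (idx j)
  idx′-inj : Injective _≡_ _≡_ idx′
  idx′-inj {zero}  {zero}  _  = refl
  idx′-inj {suc j} {suc k} eq = cong suc (idx-inj (sucᶠ-injective eq))
  sat′ : ∀ j → P (idx′ j) ≡ true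
  sat′ zero    = P₀
  sat′ (suc j) = sat j
... | false | idx , idx-inj , sat = suc ∘ idx , idx-inj ∘ sucᶠ-injective , sat

∣∣≡count : ∀ {n} (p : Subset n) → ∣ p ∣ ≡ count (lookup p)
∣∣≡count []          = refl
∣∣≡count (true  ∷ p) = cong suc (∣∣≡count p)
∣∣≡count (false ∷ p) = ∣∣≡count p

-- Split the vertex set Fin (N * q) into q columns
-- {combine a x ∣ a ∈ Fin N} of N vertices (x ∈ Fin q).  A tuple τ of q
-- permutations of Fin N colours combine a x with perm (τ x) a, so every
-- colour class meets every column exactly once: the colour classes are the
-- N parts, with q vertices each, of an N-partite structure, in which every
-- rainbow edge is a partite edge.  By chains-bound each N-edge is rainbow
-- for at least a fraction N!/N^N of the tuples; averaging yields one tuple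
-- with that many rainbow edges, which then give the PHF as in partitePHF.
module Recolouring (N q : ℕ) (x₀ : Fin q) where

  -- A colouring is given by a tuple of codes of permutations of Fin N, one per
  -- column; vertex v = combine (row v) (col v) is in column col v.
  Tuple : Set
  Tuple = Fin q → Fin (N !)

  row : Fin (N * q) → Fin N
  row = quotient {N} q

  col : Fin (N * q) → Fin q
  col = remainder {N} q

  column : Subset (N * q) → Fin q → Fin N → Bool
  column e x a = lookup e (combine a x)

  total-column : ∀ e → total (column e) ≡ ∣ e ∣
  total-column e = begin
    ∑[ x < q ] ∑[ a < N ] ind (lookup e (combine a x))  ≡⟨ ∑-comm {q} {N} (λ x a → ind (lookup e (combine a x))) ⟩
    ∑[ a < N ] ∑[ x < q ] ind (lookup e (combine a x))  ≡⟨ sum-combine N q (ind ∘ lookup e) ⟨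
    count (lookup e)                                    ≡⟨ ∣∣≡count e ⟨
    ∣ e ∣                                               ∎
    where open ≡-Reasoning

  colour : Tuple → Fin (N * q) → Fin N
  colour τ v = perm (τ (col v)) (row v)

  -- e is rainbow under τ when the chain of its columns into all colours succeeds.
  rainbow : Tuple → Subset (N * q) → Bool
  rainbow τ e = chain (column e) (λ _ → true) τ

  colour-injective : ∀ τ e → rainbow τ e ≡ true → ∀ {v w} → lookup e v ≡ true → lookup e w ≡ true →
    colour τ v ≡ colour τ w → v ≡ w
  colour-injective τ e ok {v} {w} v∈e w∈e same with col v ≟ᶠ col w
  ... | yes cv≡cw = begin
    v                         ≡⟨ combine-remQuot {N} q v ⟨
    combine (row v) (col v)   ≡⟨ cong₂ combine (perm-injective (τ (col w)) (subst (λ x → perm (τ x) (row v) ≡ _) cv≡cw same)) cv≡cw ⟩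
    combine (row w) (col w)   ≡⟨ combine-remQuot {N} q w ⟩
    w                         ∎
    where open ≡-Reasoning
  ... | no  cv≢cw = contradiction same (chain-disjoint (column e) (λ _ → true) τ ok cv≢cw
    (trans (cong (lookup e) (combine-remQuot {N} q v)) v∈e)
    (trans (cong (lookup e) (combine-remQuot {N} q w)) w∈e))

  rainbow-count : ∀ e → ∣ e ∣ ≡ N → (N !) ^ q * N ! ≤ chains q (column e) (λ _ → true) * N ^ N
  rainbow-count e ∣e∣≡N = subst₂ _≤_
    (trans (cong₂ (λ s S → (N !) ^ q * falling s S) count-all S≡N) (cong ((N !) ^ q *_) (falling-self N)))
    (cong (λ S → chains q (column e) (λ _ → true) * N ^ S) S≡N)
    (chains-bound q (column e) (λ _ → true))
    where
    S≡N : total (column e) ≡ N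
    S≡N = trans (total-column e) ∣e∣≡N
    count-all : count {N} (λ _ → true) ≡ N
    count-all = trans (sum-const N 1) (*-identityʳ N)

  -- cell τ i x: the vertex of colour i in column x.
  cell : Tuple → Fin N → Fin q → Fin (N * q)
  cell τ i x = combine (unperm (τ x) i) x

  cell-colour : ∀ τ v → cell τ (colour τ v) (col v) ≡ v
  cell-colour τ v = trans (cong (λ a → combine a (col v)) (unperm-perm (τ (col v)) (row v)))
                          (combine-remQuot {N} q v)

  -- transversal τ e i: the column of the vertex of e with colour i (if any).
  transversal : Tuple → Subset (N * q) → Fin N → Fin q
  transversal τ e i with any? (λ v → (lookup e v ≟ᵇ true) ×-dec (colour τ v ≟ᶠ i))
  ... | yes (v , _) = col v
  ... | no  _       = x₀

  transversal-colour : ∀ τ e → rainbow τ e ≡ true → ∀ v → lookup e v ≡ true →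
    transversal τ e (colour τ v) ≡ col v
  transversal-colour τ e ok v v∈e with any? (λ w → (lookup e w ≟ᵇ true) ×-dec (colour τ w ≟ᶠ colour τ v))
  ... | yes (w , w∈e , same) = cong col (colour-injective τ e ok w∈e v∈e same)
  ... | no  none             = contradiction (v , v∈e , refl) none

  covered : ∀ τ e → rainbow τ e ≡ true → e ⊆ Union (λ i → ⁅ cell τ i (transversal τ e i) ⁆)
  covered τ e ok {v} v∈e = ∈Union⁺ (λ i → ⁅ cell τ i (transversal τ e i) ⁆) (colour τ v) (≡⇒∈⁅⁆ (sym (begin
    cell τ (colour τ v) (transversal τ e (colour τ v)) ≡⟨ cong (cell τ (colour τ v)) (transversal-colour τ e ok v ([]=⇒lookup v∈e)) ⟩
    cell τ (colour τ v) (col v)                        ≡⟨ cell-colour τ v ⟩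
    v                                                  ∎)))
    where open ≡-Reasoning

  manyRainbow : ∀ m (E : Fin m → Subset (N * q)) → Uniform N E →
    ∃ λ (τ : Tuple) → N ! * m ≤ count (λ j → rainbow τ (E j)) * N ^ N
  manyRainbow m E unif =
    Σ-map finToFun (λ bound → bound) (averaging {{m^n≢0 (N !) q {{N !≢0}}}} R (λ _ → N ! * m) totals)
    where
    tuples = (N !) ^ q
    R : Fin tuples → ℕ
    R τ = count (λ j → rainbow (finToFun τ) (E j)) * N ^ N
    reorder : ∀ a b c → a * (b * c) ≡ c * (a * b)
    reorder = solve-∀
    totals : ∑[ τ < tuples ] (N ! * m) ≤ sum R
    totals = begin
      ∑[ τ < tuples ] (N ! * m)                                                 ≡⟨ sum-const tuples (N ! * m) ⟩
      tuples * (N ! * m)                                                        ≡⟨ reorder tuples (N !) m ⟩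
      m * (tuples * N !)                                                        ≡⟨ sum-const m _ ⟨
      ∑[ j < m ] (tuples * N !)                                                 ≤⟨ sum-mono-≤ (λ j → rainbow-count (E j) (unif j)) ⟩
      ∑[ j < m ] (chains q (column (E j)) (λ _ → true) * N ^ N)                  ≡⟨ *-distribʳ-sum (N ^ N) (λ j → chains q (column (E j)) (λ _ → true)) ⟨
      (∑[ j < m ] ∑[ τ < tuples ] ind (rainbow (finToFun τ) (E j))) * N ^ N     ≡⟨ cong (_* N ^ N) (∑-comm {m} {tuples} (λ j τ → ind (rainbow (finToFun τ) (E j)))) ⟩
      (∑[ τ < tuples ] count (λ j → rainbow (finToFun τ) (E j))) * N ^ N        ≡⟨ *-distribʳ-sum (N ^ N) (λ τ → count (λ j → rainbow (finToFun τ) (E j))) ⟩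
      sum R                                                                     ∎
      where open ≤-Reasoning

  rainbowPHF : ∀ t m (E : Fin m → Subset (N * q)) → Uniform N E → Free (t * N ∸ N) t E →
    ∃₂ λ (n : ℕ) (M : Fin N → Fin n → Fin q) → IsPHF t M × N ! * m ≤ N ^ N * n
  rainbowPHF t m E unif free with manyRainbow m E unif
  ... | τ , bound with select (λ j → rainbow τ (E j))
  ...   | idx , idx-inj , isRainbow =
    _ , (λ r c → transversal τ (E (idx c)) r) , isPHF t free′ , subst (N ! * m ≤_) (*-comm _ (N ^ N)) bound
    where
    open TransversalCover (cell τ) (λ c → transversal τ (E (idx c))) (E ∘ idx)
                          (λ c → covered τ (E (idx c)) (isRainbow c))
    free′ : (c : Fin t → Fin _) → Injective _≡_ _≡_ c → t * N ∸ N < ∣ Union (E ∘ idx ∘ c) ∣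
    free′ c c-inj = free (idx ∘ c) (c-inj ∘ idx-inj)

theorem7p1 : (t N q : ℕ) → 1 ≤ t → 1 ≤ N → 1 ≤ q →
    ((m : ℕ) (E : Fin m → Vec (Fin q) N) → Injective _≡_ _≡_ E →
      Free (t * N ∸ N) t (λ i → partiteEdge (E i)) →
      ∃₂ λ (n : ℕ) (M : Fin N → Fin n → Fin q) → IsPHF t M × m ≤ n)
    ×
    ((m : ℕ) (E : Fin m → Subset (N * q)) → Distinct E → Uniform N E →
      Free (t * N ∸ N) t E →
      ∃₂ λ (n : ℕ) (M : Fin N → Fin n → Fin q) → IsPHF t M × (N !) * m ≤ (N ^ N) * n)
-- The first bound is partitePHF; for the second, Fin q is inhabited (q ≥ 1),
-- which supplies a default column for absent colours in Recolouring.
theorem7p1 t N (suc q′) _ _ _ =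
  (λ m E _ → partitePHF t N (suc q′) m E) ,
  (λ m E _ → Recolouring.rainbowPHF N (suc q′) zero t m E)
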